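{- Let $n>11$ be an integer, $r=n-4$, let $G$ be an $r$-regular graph with $V(G)=\{v_1,\dots,v_n\}$ and $E(G)=\{e_1,\dots,e_m\}$, and let $H$ be the bipartite graph constructed from $G$ as in the context. Let $k$ be a positive integer with $k\le r$ and suppose $G$ contains no clique of size $k$. Let $x = m-\left(kr-\binom{k}{2}\right)$. Then (i) $q_k(H)\le x-1$, and (ii) for every $i\in[r-k]$, $q_{k+i}(H)\le q_{k+i-1}(H)-\bigl(r-(k+i-2)\bigr)$.
   Context: Construction of $H$: $H$ is bipartite with parts $A=\{a_1,\dots,a_m\}$ and $B=\beta\cup\Pi$, where $\beta=\{b_1,\dots,b_n\}$ and $\Pi=\{p_{i,j}: i\in[m], j\in[r-3]\}$; $E(H)=\{a_ip_{i,j}: i\in[m], j\in[r-3]\}\cup\{a_ib_j: e_i \text{ is incident to } v_j \text{ in } G\}$. For $S\subseteq\beta$, $q(S)=\max\{|X| : X\subseteq A \text{ and no vertex of } X \text{ is adjacent to any vertex of } S\}$. For an integer $i$ with $0\le i\le r-k$, $q_{k+i}(H)=\max\{q(S) : S\subseteq\beta,\ |S|=k+i\}$. $[N]=\{1,\dots,N\}$. -}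

module Defs where

open import Data.Bool using (Bool; true; false; if_then_else_; _∧_; _∨_; not)
open import Data.Nat using (ℕ; zero; suc; _+_; _*_; _∸_; _≤_; _<_; _⊔_)
open import Data.Fin using (Fin; _≟_)
open import Data.Fin.Subset using (Subset; ∣_∣; _∈_)
open import Data.Product using (_×_; _,_; proj₁; proj₂; ∃; ∃-syntax)
open import Data.Sum using (_⊎_; inj₁; inj₂)
open import Data.List using (List; []; _∷_; map; _++_)
open import Data.Vec using (Vec; []; _∷_; tabulate; lookup)
open import Relation.Binary.PropositionalEquality using (_≡_; _≢_)
open import Relation.Nullary.Decidable using (⌊_⌋)

-- A finite simple graph G with vertex set {v_1..v_n} (as Fin n) and an
-- enumerated edge set {e_1..e_m} (as Fin m); edge e_i has endpoints ends i.
record Graph (n m : ℕ) : Set where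
  field
    ends     : Fin m → Fin n × Fin n
    loopless : ∀ i → proj₁ (ends i) ≢ proj₂ (ends i)
    noMulti  : ∀ i j →
      ((proj₁ (ends i) ≡ proj₁ (ends j) × proj₂ (ends i) ≡ proj₂ (ends j))
        ⊎ (proj₁ (ends i) ≡ proj₂ (ends j) × proj₂ (ends i) ≡ proj₁ (ends j)))
      → i ≡ j

module _ {n m : ℕ} (G : Graph n m) where
  open Graph G

  incident : Fin m → Fin n → Bool
  incident i v = ⌊ v ≟ proj₁ (ends i) ⌋ ∨ ⌊ v ≟ proj₂ (ends i) ⌋

  Adj : Fin n → Fin n → Set
  Adj u v = u ≢ v × ∃[ i ] (incident i u ≡ true × incident i v ≡ true)

  degree : Fin n → ℕ
  degree v = ∣ tabulate (λ i → incident i v) ∣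

  Regular : ℕ → Set
  Regular r = ∀ v → degree v ≡ r

  HasClique : ℕ → Set
  HasClique k = ∃[ K ] (∣ K ∣ ≡ k × (∀ u v → u ∈ K → v ∈ K → u ≢ v → Adj u v))

allSubsets : ∀ n → List (Subset n)
allSubsets zero = [] ∷ []
allSubsets (suc n) = map (true ∷_) (allSubsets n) ++ map (false ∷_) (allSubsets n)

maxOver : ∀ {A : Set} → (A → Bool) → (A → ℕ) → List A → ℕ
maxOver p f [] = 0
maxOver p f (x ∷ xs) = if p x then f x ⊔ maxOver p f xs else maxOver p f xs

allFinB : ∀ {n} → (Fin n → Bool) → Bool
allFinB {n} f = Data.Vec.foldr _ _∧_ true (tabulate f)
  where import Data.Vec

-- The bipartite graph H: parts A = {a_i : i ∈ Fin m} and
-- B = β ∪ Π with β = {b_j : j ∈ Fin n}, Π = {p_{i,j} : i ∈ Fin m, j ∈ Fin (r-3)}.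
BVertex : ℕ → ℕ → ℕ → Set
BVertex n m r = Fin n ⊎ (Fin m × Fin (r ∸ 3))

module _ {n m : ℕ} (G : Graph n m) (r : ℕ) where

  adjH : Fin m → BVertex n m r → Bool
  adjH i (inj₁ j) = incident G i j
  adjH i (inj₂ (i' , _)) = ⌊ i ≟ i' ⌋

  Avoids : Subset n → Subset m → Bool
  Avoids S X = allFinB (λ i → not (lookup X i) ∨
                 allFinB (λ j → not (lookup S j) ∨ not (adjH i (inj₁ j))))

  q : Subset n → ℕ
  q S = maxOver (Avoids S) ∣_∣ (allSubsets m)

  qH : ℕ → ℕ
  qH t = maxOver (λ S → ⌊ ∣ S ∣ Data.Nat.≟ t ⌋) q (allSubsets n)
    where import Data.Nat

module Submission where

-- For a set S of vertices of G, the sets X ⊆ A avoiding S are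
-- exactly the sets of edges of G that miss S, so  q(S)  is the number
-- outerEdges S  of edges of G disjoint from S, and  q_t(H)  is the largest
-- such number over t-sets S.  The whole argument rests on one deletion
-- inequality: if u ∈ S and T = S - u, then
--     outerEdges T + |{edges from u into T}| = outerEdges S + deg u,
-- and the edges from u into T inject into T via their other endpoint
-- (G is simple); if S also contains a non-neighbour w of u, they inject into
-- T - w.  For r-regular G this gives  outerEdges S + r ≤ outerEdges T + |T|,
-- strictly if S is not a clique.  Iterating the weak form bounds
-- outerEdges S + s·r by m + C(s,2) for |S| = s; one strict step on a k-set,
-- which is never a clique, gives (i), and a single strict step on a
-- (k+i)-set gives (ii).

open import Defs
open import Data.Nat using (ℕ; _<_; _≤_; _∸_; _*_; _+_)
open import Data.Nat.Combinatorics using (_C_)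
open import Data.Integer using (ℤ; +_; _-_) renaming (_≤_ to _≤ℤ_)
open import Relation.Binary.PropositionalEquality using (_≡_)
open import Relation.Nullary using (¬_)
open import Data.Product using (_×_)

open import Algebra.Bundles using (CommutativeMonoid)
open import Data.Bool using (Bool; true; false; if_then_else_; _∧_; _∨_; not)
import Data.Bool as Bool
open import Data.Bool.Properties
  using (∧-comm; ∧-identityʳ; ∧-zeroʳ; ∨-identityʳ; ∨-zeroʳ;
         ∨-commutativeMonoid; ∨-∧-booleanAlgebra)
open import Algebra.Properties.CommutativeSemigroup
  (CommutativeMonoid.commutativeSemigroup ∨-commutativeMonoid)
  using () renaming (interchange to ∨-interchange)
open import Algebra.Lattice.Properties.BooleanAlgebra ∨-∧-booleanAlgebra using (deMorgan₂)
open import Data.Empty using (⊥-elim)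
open import Data.Fin using (Fin; zero; suc; _≟_)
import Data.Fin.Properties as Fin
open import Data.Fin.Subset using (Subset; ∣_∣; _∈_; ⊤)
open import Data.Fin.Subset.Properties using (∣⊤∣≡n)
open import Data.Integer using (+≤+) renaming (_+_ to _+ℤ_; -_ to -ℤ_)
import Data.Integer.Properties as ℤ
open import Data.Integer.Tactic.RingSolver using () renaming (solve-∀ to ℤsolve-∀)
open import Data.List using ([]; _∷_; map)
open import Data.List.Membership.Propositional using () renaming (_∈_ to _∈ₗ_)
open import Data.List.Membership.Propositional.Properties using (∈-map⁺; ∈-++⁺ˡ; ∈-++⁺ʳ)
open import Data.List.Relation.Unary.Any using (here; there)
open import Data.Nat using (zero; suc; z≤n; s≤s)
import Data.Nat as ℕ
open import Data.Nat.Combinatorics using (nCk+nC[k+1]≡[n+1]C[k+1]; nC1≡n)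
open import Data.Nat.Properties
  using (+-assoc; +-comm; +-identityʳ; +-suc; suc-injective; +-mono-≤; +-monoʳ-≤; +-monoˡ-≤;
         +-monoʳ-<; m≤n+m; m≤m+n; m∸n≤m; m+[n∸m]≡n; ≤-refl; ≤-reflexive; ≤-antisym; ≤-trans;
         ⊔-lub; m≤m⊔n; m≤n⊔m; +-distribʳ-⊔; module ≤-Reasoning)
open import Data.Nat.Tactic.RingSolver using (solve-∀)
open import Data.Product using (_,_; proj₁; proj₂; ∃-syntax)
open import Data.Sum using (_⊎_; inj₁; inj₂)
open import Data.Vec using ([]; _∷_; tabulate; lookup)
open import Data.Vec.Properties using (lookup∘tabulate; []=⇒lookup)
open import Relation.Binary.PropositionalEquality
  using (_≢_; refl; sym; trans; cong; cong₂; subst; subst₂; module ≡-Reasoning)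
open import Relation.Nullary.Decidable using (Dec; ⌊_⌋; yes; no; ¬?; _×-dec_)

excluded : ∀ a b → not a ∨ not b ≡ true → b ≡ true → a ≡ false
excluded false b     _  _  = refl
excluded true  true  () _
excluded true  false _  ()

neither : ∀ a b → not (a ∨ b) ≡ true → a ≡ false × b ≡ false
neither false false _ = refl , refl
neither false true  ()
neither true  _     ()

∧-true₁ : ∀ {a b} → a ∧ b ≡ true → a ≡ true
∧-true₁ {true} _ = refl

∧-true₂ : ∀ {a b} → a ∧ b ≡ true → b ≡ true
∧-true₂ {true} h = h

resolve : ∀ a b → not a ∨ b ≡ true → a ≡ true → b ≡ true
resolve true b h _ = h

⌊⌋-sound : ∀ {A : Set} (a? : Dec A) → ⌊ a? ⌋ ≡ true → A
⌊⌋-sound (yes a) _ = a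

⌊⌋-complete : ∀ {A : Set} (a? : Dec A) → A → ⌊ a? ⌋ ≡ true
⌊⌋-complete (yes _) _ = refl
⌊⌋-complete (no ¬a) a = ⊥-elim (¬a a)

bit : Bool → ℕ
bit true  = 1
bit false = 0

count : ∀ {n} → (Fin n → Bool) → ℕ
count {zero}  f = 0
count {suc n} f = bit (f zero) + count (λ i → f (suc i))

count-cong : ∀ {n} {f g : Fin n → Bool} → (∀ i → f i ≡ g i) → count f ≡ count g
count-cong {zero}  e = refl
count-cong {suc n} e = cong₂ _+_ (cong bit (e zero)) (count-cong (λ i → e (suc i)))

count≤n : ∀ {n} (f : Fin n → Bool) → count f ≤ n
count≤n {zero}  f = z≤n
count≤n {suc n} f = +-mono-≤ (bit≤1 (f zero)) (count≤n (λ i → f (suc i)))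
  where
  bit≤1 : ∀ b → bit b ≤ 1
  bit≤1 true  = s≤s z≤n
  bit≤1 false = z≤n

count-split : ∀ {n} (f g : Fin n → Bool) →
  count f ≡ count (λ i → f i ∧ g i) + count (λ i → f i ∧ not (g i))
count-split {zero}  f g = refl
count-split {suc n} f g =
  trans (cong₂ _+_ (bit-split (f zero) (g zero)) (count-split f′ g′))
        (+-interchange (bit (f zero ∧ g zero)) (bit (f zero ∧ not (g zero))) _ _)
  where
  f′ g′ : Fin n → Bool
  f′ i = f (suc i)
  g′ i = g (suc i)
  bit-split : ∀ a b → bit a ≡ bit (a ∧ b) + bit (a ∧ not b)
  bit-split true  true  = refl
  bit-split true  false = refl
  bit-split false b     = refl
  +-interchange : ∀ a b c d → (a + b) + (c + d) ≡ (a + c) + (b + d)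
  +-interchange = solve-∀

remove : ∀ {n} → (Fin n → Bool) → Fin n → Fin n → Bool
remove f v i = f i ∧ not ⌊ v ≟ i ⌋

remove-⊆ : ∀ {n} (f : Fin n → Bool) v i → remove f v i ≡ true → f i ≡ true
remove-⊆ f v i h with f i
... | true  = refl
... | false = h

remove-self : ∀ {n} (f : Fin n → Bool) v → remove f v v ≡ false
remove-self f v with v ≟ v
... | yes _  = ∧-zeroʳ (f v)
... | no v≢v = ⊥-elim (v≢v refl)

remove-other : ∀ {n} (f : Fin n → Bool) {v i} → i ≢ v → remove f v i ≡ f i
remove-other f {v} {i} i≢v with v ≟ i
... | yes v≡i = ⊥-elim (i≢v (sym v≡i))
... | no _    = ∧-identityʳ (f i)

count-remove : ∀ {n} (f : Fin n → Bool) v → f v ≡ true → count f ≡ suc (count (remove f v))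
count-remove f zero    fv rewrite fv = cong suc (count-cong (λ i → sym (∧-identityʳ (f (suc i)))))
count-remove f (suc v) fv rewrite ∧-identityʳ (f zero) = begin
    bit (f zero) + count (λ i → f (suc i))
      ≡⟨ cong (λ c → bit (f zero) + c) (count-remove (λ i → f (suc i)) v fv) ⟩
    bit (f zero) + suc (count (remove (λ i → f (suc i)) v))
      ≡⟨ +-suc (bit (f zero)) _ ⟩
    suc (bit (f zero) + count (remove (λ i → f (suc i)) v))
      ≡⟨ cong (λ c → suc (bit (f zero) + c)) (count-cong remove-suc) ⟩
    suc (bit (f zero) + count (λ i → remove f (suc v) (suc i))) ∎
  where
  open ≡-Reasoning
  remove-suc : ∀ i → remove (λ j → f (suc j)) v i ≡ remove f (suc v) (suc i)
  remove-suc i with v ≟ i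
  ... | yes _ = refl
  ... | no _  = refl

remove-size : ∀ {n} (f : Fin n → Bool) v {s} → f v ≡ true → count f ≡ suc s →
  count (remove f v) ≡ s
remove-size f v fv f-size = suc-injective (trans (sym (count-remove f v fv)) f-size)

count-injection : ∀ {m n} (P : Fin m → Bool) (Q : Fin n → Bool) (h : Fin m → Fin n) →
  (∀ i j → P i ≡ true → P j ≡ true → h i ≡ h j → i ≡ j) →
  (∀ i → P i ≡ true → Q (h i) ≡ true) → count P ≤ count Q
count-injection {zero}  P Q h inj into = z≤n
count-injection {suc m} P Q h inj into with P zero in P₀
... | false = count-injection (λ i → P (suc i)) Q (λ i → h (suc i))
                (λ i j Pi Pj e → Fin.suc-injective (inj _ _ Pi Pj e)) (λ i → into (suc i))
... | true rewrite count-remove Q (h zero) (into zero P₀) =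
  s≤s (count-injection (λ i → P (suc i)) (remove Q (h zero)) (λ i → h (suc i))
        (λ i j Pi Pj e → Fin.suc-injective (inj _ _ Pi Pj e))
        (λ i Pi → trans (remove-other Q (λ e → Fin.0≢1+n (inj _ _ P₀ Pi (sym e)))) (into (suc i) Pi)))

count-witness : ∀ {n} (f : Fin n → Bool) {s} → count f ≡ suc s → ∃[ v ] f v ≡ true
count-witness {suc n} f e with f zero in f₀
... | true  = zero , f₀
... | false = let (v , fv) = count-witness (λ i → f (suc i)) e in suc v , fv

∣∣≡count : ∀ {n} (p : Subset n) → ∣ p ∣ ≡ count (lookup p)
∣∣≡count []          = refl
∣∣≡count (true ∷ p)  = cong suc (∣∣≡count p)
∣∣≡count (false ∷ p) = ∣∣≡count p

∣tabulate∣≡count : ∀ {n} (f : Fin n → Bool) → ∣ tabulate f ∣ ≡ count f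
∣tabulate∣≡count f = trans (∣∣≡count (tabulate f)) (count-cong (lookup∘tabulate f))

subset-of-size : ∀ {n} k d (S : Fin n → Bool) → count S ≡ k + d →
  ∃[ K ] (count K ≡ k × (∀ v → K v ≡ true → S v ≡ true))
subset-of-size k zero    S e = S , trans e (+-identityʳ k) , λ v Kv → Kv
subset-of-size k (suc d) S e with count-witness S (trans e (+-suc k d))
... | u , Su with subset-of-size k d (remove S u) (remove-size S u Su (trans e (+-suc k d)))
...   | K , K-size , K⊆ = K , K-size , λ v Kv → remove-⊆ S u v (K⊆ v Kv)

-- A bound B on every candidate, shifted by c, bounds the maximum (shifted by c);
-- the hypothesis c ≤ B covers the empty maximum 0.
maxOver-bound : ∀ {A : Set} (p : A → Bool) (f : A → ℕ) (c B : ℕ) xs → c ≤ B →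
  (∀ x → p x ≡ true → f x + c ≤ B) → maxOver p f xs + c ≤ B
maxOver-bound p f c B []       c≤B h = c≤B
maxOver-bound p f c B (x ∷ xs) c≤B h with p x in px
... | true  = subst (_≤ B) (sym (+-distribʳ-⊔ c (f x) _))
                (⊔-lub (h x px) (maxOver-bound p f c B xs c≤B h))
... | false = maxOver-bound p f c B xs c≤B h

maxOver-≤ : ∀ {A : Set} (p : A → Bool) (f : A → ℕ) (B : ℕ) xs →
  (∀ x → p x ≡ true → f x ≤ B) → maxOver p f xs ≤ B
maxOver-≤ p f B xs h = subst (_≤ B) (+-identityʳ _)
  (maxOver-bound p f 0 B xs z≤n λ x px → subst (_≤ B) (sym (+-identityʳ (f x))) (h x px))

maxOver-∈ : ∀ {A : Set} (p : A → Bool) (f : A → ℕ) {x xs} → x ∈ₗ xs → p x ≡ true →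
  f x ≤ maxOver p f xs
maxOver-∈ p f {x} (here refl) px rewrite px = m≤m⊔n (f x) _
maxOver-∈ p f {xs = y ∷ ys} (there x∈) px with p y
... | true  = ≤-trans (maxOver-∈ p f x∈ px) (m≤n⊔m (f y) _)
... | false = maxOver-∈ p f x∈ px

allSubsets-complete : ∀ {n} (p : Subset n) → p ∈ₗ allSubsets n
allSubsets-complete []          = here refl
allSubsets-complete (true ∷ p)  = ∈-++⁺ˡ (∈-map⁺ (true ∷_) (allSubsets-complete p))
allSubsets-complete (false ∷ p) =
  ∈-++⁺ʳ (map (true ∷_) (allSubsets _)) (∈-map⁺ (false ∷_) (allSubsets-complete p))

allFinB-elim : ∀ {n} (f : Fin n → Bool) → allFinB f ≡ true → ∀ i → f i ≡ true
allFinB-elim {suc n} f h i with f zero in f₀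
allFinB-elim {suc n} f ()  i       | false
allFinB-elim {suc n} f h  zero     | true = f₀
allFinB-elim {suc n} f h  (suc i)  | true = allFinB-elim (λ j → f (suc j)) h i

allFinB-intro : ∀ {n} (f : Fin n → Bool) → (∀ i → f i ≡ true) → allFinB f ≡ true
allFinB-intro {zero}  f h = refl
allFinB-intro {suc n} f h rewrite h zero = allFinB-intro (λ j → f (suc j)) (λ i → h (suc i))

C-suc : ∀ s → suc s C 2 ≡ s C 2 + s
C-suc s = begin
  suc s C 2       ≡⟨ sym (nCk+nC[k+1]≡[n+1]C[k+1] s 1) ⟩
  s C 1 + s C 2   ≡⟨ cong (_+ s C 2) (nC1≡n s) ⟩
  s + s C 2       ≡⟨ +-comm s (s C 2) ⟩
  s C 2 + s       ∎
  where open ≡-Reasoning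

-- One step of the iterated degree count: if deleting a vertex from an
-- (s+1)-set costs at most s edges beyond the degree r, the bound
-- y + s·r ≤ m + C(s,2) for the remaining s-set lifts to the (s+1)-set.
peel : ∀ {r m x y} s → x + r ≤ y + s → y + s * r ≤ m + s C 2 →
  x + suc s * r ≤ m + suc s C 2
peel {r} {m} {x} {y} s step bound = begin
  x + (r + s * r)   ≡⟨ sym (+-assoc x r (s * r)) ⟩
  x + r + s * r     ≤⟨ +-monoˡ-≤ (s * r) step ⟩
  y + s + s * r     ≡⟨ swap₂₃ y s (s * r) ⟩
  y + s * r + s     ≤⟨ +-monoˡ-≤ s bound ⟩
  m + s C 2 + s     ≡⟨ +-assoc m (s C 2) s ⟩
  m + (s C 2 + s)   ≡⟨ cong (λ c → m + c) (sym (C-suc s)) ⟩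
  m + suc s C 2     ∎
  where
  open ≤-Reasoning
  swap₂₃ : ∀ a b c → a + b + c ≡ a + c + b
  swap₂₃ = solve-∀

shift : ∀ {a b} c → a + c ≤ b → + a ≤ℤ + b - + c
shift {a} {b} c h = begin
  + a                  ≡⟨ cancel (+ a) (+ c) ⟩
  (+ a +ℤ + c) - + c   ≡⟨ cong (_- + c) (sym (ℤ.pos-+ a c)) ⟩
  + (a + c) - + c      ≤⟨ ℤ.+-monoˡ-≤ (-ℤ + c) (+≤+ h) ⟩
  + b - + c            ∎
  where
  open ℤ.≤-Reasoning
  cancel : ∀ x y → x ≡ (x +ℤ y) - y
  cancel = ℤsolve-∀

module _ {n m : ℕ} (G : Graph n m) where
  open Graph G

  end₁ end₂ : Fin m → Fin n
  end₁ i = proj₁ (ends i)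
  end₂ i = proj₂ (ends i)

  meets : (Fin n → Bool) → Fin m → Bool
  meets S i = S (end₁ i) ∨ S (end₂ i)

  outerEdges : (Fin n → Bool) → ℕ
  outerEdges S = count (λ i → not (meets S i))

  outerEdges-cong : ∀ {S S′} → (∀ v → S v ≡ S′ v) → outerEdges S ≡ outerEdges S′
  outerEdges-cong e = count-cong λ i → cong₂ (λ a b → not (a ∨ b)) (e (end₁ i)) (e (end₂ i))

  incident-end₁ : ∀ i → incident G i (end₁ i) ≡ true
  incident-end₁ i with end₁ i ≟ end₁ i
  ... | yes _ = refl
  ... | no ne = ⊥-elim (ne refl)

  incident-end₂ : ∀ i → incident G i (end₂ i) ≡ true
  incident-end₂ i with end₂ i ≟ end₂ i
  ... | yes _ = ∨-zeroʳ _
  ... | no ne = ⊥-elim (ne refl)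

  incident-endpoint : ∀ i v → incident G i v ≡ true → v ≡ end₁ i ⊎ v ≡ end₂ i
  incident-endpoint i v h with v ≟ end₁ i | v ≟ end₂ i
  ... | yes e | _     = inj₁ e
  ... | no _  | yes e = inj₂ e

  misses-elim : ∀ S i → allFinB (λ j → not (S j) ∨ not (incident G i j)) ≡ true →
    not (meets S i) ≡ true
  misses-elim S i h
    rewrite excluded (S (end₁ i)) _ (allFinB-elim _ h (end₁ i)) (incident-end₁ i)
          | excluded (S (end₂ i)) _ (allFinB-elim _ h (end₂ i)) (incident-end₂ i) = refl

  misses-intro : ∀ S i → not (meets S i) ≡ true →
    allFinB (λ j → not (S j) ∨ not (incident G i j)) ≡ true
  misses-intro S i h = allFinB-intro _ λ j → outside j (incident G i j) refl
    where
    outside : ∀ j b → incident G i j ≡ b → not (S j) ∨ not b ≡ true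
    outside j false _ = ∨-zeroʳ _
    outside j true inc with incident-endpoint i j inc | neither (S (end₁ i)) _ h
    ... | inj₁ refl | S₁ , _ rewrite S₁ = refl
    ... | inj₂ refl | _ , S₂ rewrite S₂ = refl

  outerSet : Subset n → Subset m
  outerSet S = tabulate (λ i → not (meets (lookup S) i))

  outerSet-avoids : ∀ r S → Avoids G r S (outerSet S) ≡ true
  outerSet-avoids r S = allFinB-intro _ λ i →
    subst (λ b → not b ∨ _ ≡ true) (sym (lookup∘tabulate _ i))
      (admissible (not (meets (lookup S) i)) refl)
    where
    admissible : ∀ {i} b → not (meets (lookup S) i) ≡ b →
      not b ∨ allFinB (λ j → not (lookup S j) ∨ not (incident G i j)) ≡ true
    admissible false _ = refl
    admissible true  h = misses-intro (lookup S) _ h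

  avoider-bound : ∀ r S X → Avoids G r S X ≡ true → ∣ X ∣ ≤ outerEdges (lookup S)
  avoider-bound r S X av = subst (_≤ outerEdges (lookup S)) (sym (∣∣≡count X))
    (count-injection (lookup X) _ (λ i → i) (λ i j _ _ e → e)
      λ i Xi → misses-elim (lookup S) i (resolve _ _ (allFinB-elim _ av i) Xi))

  q≡outerEdges : ∀ r S → q G r S ≡ outerEdges (lookup S)
  q≡outerEdges r S = ≤-antisym
    (maxOver-≤ _ _ _ (allSubsets m) (avoider-bound r S))
    (subst (_≤ q G r S) (∣tabulate∣≡count (λ i → not (meets (lookup S) i)))
      (maxOver-∈ (Avoids G r S) ∣_∣ (allSubsets-complete (outerSet S)) (outerSet-avoids r S)))

  restore : ∀ (S : Fin n → Bool) u → S u ≡ true → ∀ v → S v ≡ remove S u v ∨ ⌊ u ≟ v ⌋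
  restore S u Su v with u ≟ v
  ... | yes refl = trans Su (sym (∨-zeroʳ _))
  ... | no _     = sym (trans (∨-identityʳ _) (∧-identityʳ (S v)))

  meets-remove : ∀ (S : Fin n → Bool) u → S u ≡ true →
    ∀ i → meets S i ≡ meets (remove S u) i ∨ incident G i u
  meets-remove S u Su i = trans (cong₂ _∨_ (restore S u Su (end₁ i)) (restore S u Su (end₂ i)))
    (∨-interchange (remove S u (end₁ i)) ⌊ u ≟ end₁ i ⌋ (remove S u (end₂ i)) ⌊ u ≟ end₂ i ⌋)

  -- Counting the edges missing S - u by whether they contain u:
  -- outerEdges (S - u) + |{edges from u to S - u}| = outerEdges S + deg u.
  deletion-identity : ∀ (S : Fin n → Bool) u → S u ≡ true →
    outerEdges (remove S u) + count (λ i → incident G i u ∧ meets (remove S u) i)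
      ≡ outerEdges S + count (λ i → incident G i u)
  deletion-identity S u Su = begin
      outerEdges T + count (λ i → at i ∧ M i)
        ≡⟨ cong (_+ count (λ i → at i ∧ M i)) (count-split (λ i → not (M i)) at) ⟩
      count (λ i → not (M i) ∧ at i) + count (λ i → not (M i) ∧ not (at i)) + count (λ i → at i ∧ M i)
        ≡⟨ cong (_+ count (λ i → at i ∧ M i))
             (cong₂ _+_ (count-cong (λ i → ∧-comm (not (M i)) (at i))) (count-cong outside-both)) ⟩
      count (λ i → at i ∧ not (M i)) + outerEdges S + count (λ i → at i ∧ M i)
        ≡⟨ rearrange (count (λ i → at i ∧ not (M i))) (outerEdges S) _ ⟩
      outerEdges S + (count (λ i → at i ∧ M i) + count (λ i → at i ∧ not (M i)))
        ≡⟨ cong (λ c → outerEdges S + c) (sym (count-split at M)) ⟩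
      outerEdges S + count at ∎
    where
    open ≡-Reasoning
    T : Fin n → Bool
    T = remove S u
    at M : Fin m → Bool
    at i = incident G i u
    M = meets T
    outside-both : ∀ i → not (M i) ∧ not (at i) ≡ not (meets S i)
    outside-both i = sym (trans (cong not (meets-remove S u Su i)) (deMorgan₂ (M i) (at i)))
    rearrange : ∀ a b c → a + b + c ≡ b + (c + a)
    rearrange = solve-∀

  other : Fin n → Fin m → Fin n
  other u i = if ⌊ u ≟ end₁ i ⌋ then end₂ i else end₁ i

  other-spec : ∀ u i → incident G i u ≡ true →
    (u ≡ end₁ i × other u i ≡ end₂ i) ⊎ (u ≡ end₂ i × other u i ≡ end₁ i)
  other-spec u i h with incident-endpoint i u h | u ≟ end₁ i
  ... | _      | yes e  = inj₁ (e , refl)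
  ... | inj₁ e | no u≢₁ = ⊥-elim (u≢₁ e)
  ... | inj₂ e | no _   = inj₂ (e , refl)

  incident-other : ∀ u i → incident G i u ≡ true → incident G i (other u i) ≡ true
  incident-other u i h with other-spec u i h
  ... | inj₁ (_ , o) = subst (λ v → incident G i v ≡ true) (sym o) (incident-end₂ i)
  ... | inj₂ (_ , o) = subst (λ v → incident G i v ≡ true) (sym o) (incident-end₁ i)

  -- Since G has no multiple edges, an edge at u is determined by its other endpoint.
  other-injective : ∀ u i j → incident G i u ≡ true → incident G j u ≡ true →
    other u i ≡ other u j → i ≡ j
  other-injective u i j hi hj eo with other-spec u i hi | other-spec u j hj
  ... | inj₁ (ei , oi) | inj₁ (ej , oj) = noMulti i j (inj₁ (trans (sym ei) ej , trans (sym oi) (trans eo oj)))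
  ... | inj₁ (ei , oi) | inj₂ (ej , oj) = noMulti i j (inj₂ (trans (sym ei) ej , trans (sym oi) (trans eo oj)))
  ... | inj₂ (ei , oi) | inj₁ (ej , oj) = noMulti i j (inj₂ (trans (sym oi) (trans eo oj) , trans (sym ei) ej))
  ... | inj₂ (ei , oi) | inj₂ (ej , oj) = noMulti i j (inj₁ (trans (sym oi) (trans eo oj) , trans (sym ei) ej))

  other-meets : ∀ (T : Fin n → Bool) u i → T u ≡ false → incident G i u ≡ true →
    meets T i ≡ true → T (other u i) ≡ true
  other-meets T u i Tu h hT with other-spec u i h
  ... | inj₁ (refl , o) rewrite Tu = subst (λ v → T v ≡ true) (sym o) hT
  ... | inj₂ (refl , o) rewrite Tu = subst (λ v → T v ≡ true) (sym o) (trans (sym (∨-identityʳ _)) hT)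

  deletion-bound : ∀ (S : Fin n → Bool) u (Q : Fin n → Bool) → S u ≡ true →
    (∀ i → incident G i u ≡ true → remove S u (other u i) ≡ true → Q (other u i) ≡ true) →
    outerEdges S + count (λ i → incident G i u) ≤ outerEdges (remove S u) + count Q
  deletion-bound S u Q Su into = subst (_≤ outerEdges T + count Q) (deletion-identity S u Su)
    (+-monoʳ-≤ (outerEdges T)
      (count-injection _ Q (other u) (λ i j hi hj → other-injective u i j (∧-true₁ hi) (∧-true₁ hj))
        λ i h → into i (∧-true₁ h) (other-meets T u i (remove-self S u) (∧-true₁ h) (∧-true₂ h))))
    where
    T : Fin n → Bool
    T = remove S u

  NonAdjacentIn : (Fin n → Bool) → Fin n → Fin n → Set
  NonAdjacentIn S u w = S u ≡ true × S w ≡ true × u ≢ w × ¬ Adj G u w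

  NonAdjacentPair : (Fin n → Bool) → Set
  NonAdjacentPair S = ∃[ u ] ∃[ w ] NonAdjacentIn S u w

  adjacent? : ∀ u v → Dec (Adj G u v)
  adjacent? u v =
    ¬? (u ≟ v) ×-dec Fin.any? (λ i → (incident G i u Bool.≟ true) ×-dec (incident G i v Bool.≟ true))

  nonAdjacentIn? : ∀ S u w → Dec (NonAdjacentIn S u w)
  nonAdjacentIn? S u w =
    (S u Bool.≟ true) ×-dec (S w Bool.≟ true) ×-dec ¬? (u ≟ w) ×-dec ¬? (adjacent? u w)

  IsClique : (Fin n → Bool) → Set
  IsClique K = ∀ u v → K u ≡ true → K v ≡ true → u ≢ v → Adj G u v

  clique-or-pair : ∀ K → IsClique K ⊎ NonAdjacentPair K
  clique-or-pair K with Fin.any? (λ u → Fin.any? (nonAdjacentIn? K u))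
  ... | yes pair = inj₂ pair
  ... | no none  = inj₁ clique
    where
    clique : IsClique K
    clique u v Ku Kv u≢v with adjacent? u v
    ... | yes adj  = adj
    ... | no ¬adj = ⊥-elim (none (u , v , Ku , Kv , u≢v , ¬adj))

  -- If G has no k-clique, every set of at least k vertices has a non-adjacent pair:
  -- its k-subsets are not cliques.
  non-adjacent-pair : ∀ {k} (S : Fin n → Bool) → ¬ HasClique G k → k ≤ count S → NonAdjacentPair S
  non-adjacent-pair {k} S no-clique k≤ with subset-of-size k (count S ∸ k) S (sym (m+[n∸m]≡n k≤))
  ... | K , K-size , K⊆S with clique-or-pair K
  ...   | inj₂ (u , w , Ku , Kw , u≢w , ¬adj) = u , w , K⊆S u Ku , K⊆S w Kw , u≢w , ¬adj
  ...   | inj₁ clique =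
    ⊥-elim (no-clique (tabulate K , trans (∣tabulate∣≡count K) K-size ,
      λ u v u∈ v∈ → clique u v (member u∈) (member v∈)))
    where
    member : ∀ {v} → v ∈ tabulate K → K v ≡ true
    member {v} v∈ = trans (sym (lookup∘tabulate K v)) ([]=⇒lookup v∈)

  module _ (r : ℕ) where

    qH-≥ : ∀ t (K : Fin n → Bool) → count K ≡ t → outerEdges K ≤ qH G r t
    qH-≥ t K K-size =
      subst (_≤ qH G r t) (trans (q≡outerEdges r (tabulate K)) (outerEdges-cong (lookup∘tabulate K)))
        (maxOver-∈ _ (q G r) (allSubsets-complete (tabulate K))
          (⌊⌋-complete (∣ tabulate K ∣ ℕ.≟ t) (trans (∣tabulate∣≡count K) K-size)))

    -- A bound on outerEdges S + c over all t-sets S bounds q_t(H) + c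
    -- (t ≤ n guarantees that some t-set exists).
    qH-bound : ∀ t c B → t ≤ n → (∀ S → count S ≡ t → outerEdges S + c ≤ B) →
      qH G r t + c ≤ B
    qH-bound t c B t≤n h = maxOver-bound _ (q G r) c B (allSubsets n) c≤B λ S size →
      subst (λ z → z + c ≤ B) (sym (q≡outerEdges r S))
        (h (lookup S) (trans (sym (∣∣≡count S)) (⌊⌋-sound (∣ S ∣ ℕ.≟ t) size)))
      where
      full : count (lookup (⊤ {n})) ≡ t + (n ∸ t)
      full = trans (sym (∣∣≡count (⊤ {n}))) (trans (∣⊤∣≡n n) (sym (m+[n∸m]≡n t≤n)))
      c≤B : c ≤ B
      c≤B with subset-of-size t (n ∸ t) (lookup ⊤) full
      ... | K , K-size , _ = ≤-trans (m≤n+m c (outerEdges K)) (h K K-size)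

    module _ (regular : Regular G r) where

      degree≡r : ∀ u → count (λ i → incident G i u) ≡ r
      degree≡r u = trans (sym (∣tabulate∣≡count (λ i → incident G i u))) (regular u)

      deletion-≤ : ∀ S u → S u ≡ true →
        outerEdges S + r ≤ outerEdges (remove S u) + count (remove S u)
      deletion-≤ S u Su = subst (λ d → outerEdges S + d ≤ _) (degree≡r u)
        (deletion-bound S u (remove S u) Su (λ _ _ h → h))

      deletion-< : ∀ S u w → NonAdjacentIn S u w →
        outerEdges S + r < outerEdges (remove S u) + count (remove S u)
      deletion-< S u w (Su , Sw , u≢w , ¬adj) = begin-strict
        outerEdges S + r                       ≡⟨ cong (λ d → outerEdges S + d) (sym (degree≡r u)) ⟩
        outerEdges S + count (λ i → incident G i u)
                                               ≤⟨ deletion-bound S u (remove T w) Su avoid-w ⟩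
        outerEdges T + count (remove T w)      <⟨ +-monoʳ-< (outerEdges T) ≤-refl ⟩
        outerEdges T + suc (count (remove T w))
                                               ≡⟨ cong (λ c → outerEdges T + c) (sym (count-remove T w Tw)) ⟩
        outerEdges T + count T                 ∎
        where
        open ≤-Reasoning
        T : Fin n → Bool
        T = remove S u
        Tw : T w ≡ true
        Tw = trans (remove-other S (λ w≡u → u≢w (sym w≡u))) Sw
        avoid-w : ∀ i → incident G i u ≡ true → T (other u i) ≡ true → remove T w (other u i) ≡ true
        avoid-w i at h = trans (remove-other T λ o≡w →
          ¬adj (u≢w , i , at , subst (λ v → incident G i v ≡ true) o≡w (incident-other u i at))) h

      outerEdges-bound : ∀ s S → count S ≡ s → outerEdges S + s * r ≤ m + s C 2
      outerEdges-bound zero S _ =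
        subst₂ _≤_ (sym (+-identityʳ _)) (sym (+-identityʳ m)) (count≤n _)
      outerEdges-bound (suc s) S S-size with count-witness S S-size
      ... | u , Su = peel s
        (subst (λ c → outerEdges S + r ≤ outerEdges (remove S u) + c) T-size (deletion-≤ S u Su))
        (outerEdges-bound s (remove S u) T-size)
        where
        T-size : count (remove S u) ≡ s
        T-size = remove-size S u Su S-size

      -- Part (i): a k-set is not a clique, so one strict deletion followed by
      -- the iterated bound gives  outerEdges S + k·r + 1 ≤ m + C(k,2).
      part-i : ∀ s → suc s ≤ n → ¬ HasClique G (suc s) →
        + qH G r (suc s) ≤ℤ (+ m - (+ (suc s * r) - + (suc s C 2))) - + 1
      part-i s k≤n no-clique = subst (+ qH G r (suc s) ≤ℤ_) rearrange
        (shift (1 + suc s * r) (qH-bound (suc s) _ _ k≤n bound))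
        where
        bound : ∀ S → count S ≡ suc s → outerEdges S + (1 + suc s * r) ≤ m + suc s C 2
        bound S S-size with non-adjacent-pair S no-clique (≤-reflexive (sym S-size))
        ... | u , w , pair@(Su , _) = subst (_≤ m + suc s C 2) (sym (+-suc (outerEdges S) _))
          (peel s deleted (outerEdges-bound s T T-size))
          where
          T : Fin n → Bool
          T = remove S u
          T-size : count T ≡ s
          T-size = remove-size S u Su S-size
          deleted : outerEdges S + r < outerEdges T + s
          deleted = subst (λ c → outerEdges S + r < outerEdges T + c) T-size (deletion-< S u w pair)
        rearrange :
          + (m + suc s C 2) - + (1 + suc s * r) ≡ (+ m - (+ (suc s * r) - + (suc s C 2))) - + 1
        rearrange = trans (cong₂ _-_ (ℤ.pos-+ m (suc s C 2)) (ℤ.pos-+ 1 (suc s * r)))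
                          (ℤ-identity (+ m) (+ (suc s C 2)) (+ (suc s * r)))
          where
          ℤ-identity : ∀ a c x → (a +ℤ c) - (+ 1 +ℤ x) ≡ (a - (x - c)) - + 1
          ℤ-identity = ℤsolve-∀

      -- Part (ii): a (t+1)-set S with t + 1 ≥ k is not a clique; one strict
      -- deletion leaves a t-set T with outerEdges T ≤ q_t(H).
      part-ii : ∀ {k} t → suc t ≤ n → k ≤ suc t → ¬ HasClique G k →
        + qH G r (suc t) ≤ℤ + qH G r t - (+ r - (+ (suc t) - + 2))
      part-ii t t+1≤n k≤ no-clique = subst (+ qH G r (suc t) ≤ℤ_) rearrange
        (shift (2 + r) (qH-bound (suc t) _ _ t+1≤n bound))
        where
        bound : ∀ S → count S ≡ suc t → outerEdges S + (2 + r) ≤ qH G r t + suc t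
        bound S S-size with non-adjacent-pair S no-clique (subst (_ ≤_) (sym S-size) k≤)
        ... | u , w , pair@(Su , _) = begin
          outerEdges S + (2 + r)               ≡⟨ +-suc (outerEdges S) (suc r) ⟩
          suc (outerEdges S + suc r)           ≡⟨ cong suc (+-suc (outerEdges S) r) ⟩
          suc (suc (outerEdges S + r))         ≤⟨ s≤s deleted ⟩
          suc (outerEdges T + t)               ≤⟨ s≤s (+-monoˡ-≤ t (qH-≥ t T T-size)) ⟩
          suc (qH G r t + t)                   ≡⟨ sym (+-suc (qH G r t) t) ⟩
          qH G r t + suc t                     ∎
          where
          open ≤-Reasoning
          T : Fin n → Bool
          T = remove S u
          T-size : count T ≡ t
          T-size = remove-size S u Su S-size
          deleted : outerEdges S + r < outerEdges T + t
          deleted = subst (λ c → outerEdges S + r < outerEdges T + c) T-size (deletion-< S u w pair)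
        rearrange : + (qH G r t + suc t) - + (2 + r) ≡ + qH G r t - (+ r - (+ (suc t) - + 2))
        rearrange = trans (cong₂ _-_ (ℤ.pos-+ (qH G r t) (suc t)) (ℤ.pos-+ 2 r))
                          (ℤ-identity (+ qH G r t) (+ suc t) (+ r))
          where
          ℤ-identity : ∀ a x y → (a +ℤ x) - (+ 2 +ℤ y) ≡ a - (y - (x - + 2))
          ℤ-identity = ℤsolve-∀

-- The theorem.
lemma3 : (n m r : ℕ) → 11 < n → r ≡ n ∸ 4 → (G : Graph n m) → Regular G r →
    (k : ℕ) → 1 ≤ k → k ≤ r → ¬ HasClique G k →
    (+ qH G r k ≤ℤ (+ m - (+ (k * r) - + (k C 2))) - + 1)
    × ((i : ℕ) → 1 ≤ i → i ≤ r ∸ k →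
    + qH G r (k + i) ≤ℤ + qH G r (k + i ∸ 1) - (+ r - (+ (k + i) - + 2)))
lemma3 n m r _ r≡n∸4 G regular k@(suc s) _ k≤r no-clique =
    part-i G r regular s (≤-trans k≤r r≤n) no-clique
  , λ { i@(suc _) _ i≤r∸k → part-ii G r regular _ (k+i≤n i i≤r∸k) (m≤m+n k i) no-clique }
  where
  r≤n : r ≤ n
  r≤n = subst (_≤ n) (sym r≡n∸4) (m∸n≤m n 4)
  k+i≤n : ∀ i → i ≤ r ∸ k → k + i ≤ n
  k+i≤n i i≤r∸k = ≤-trans (subst (k + i ≤_) (m+[n∸m]≡n k≤r) (+-monoʳ-≤ k i≤r∸k)) r≤n
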